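{- Let $G$ be a finite simple graph with at least one vertex and maximum degree at most $\Delta$, let $t\ge 1$, $k$ and $\ell\ge 0$ be integers with $\Delta\ge 0$ and $\ell+\Delta>0$, and let $w:V(G)\to\mathbb{Z}$ be a function with \[ k_t(G)=\frac1t\sum_{v\in V(G)}w(v). \] Suppose $w(v)\le k$ for all $v\in V(G)$, and every vertex $v$ with $w(v)=k$ has at least $\ell$ neighbors $u$ with $w(u)\le k-1$. Then \[ \rho_t(G)\le\frac1t\left(k-\frac{\ell}{\ell+\Delta}\right). \]
   Context: For a graph $G$, $k_t(G)$ denotes the number of copies of $K_t$ in $G$, and $\rho_t(G)=k_t(G)/|V(G)|$. -}

module Defs where

open import Data.Bool using (Bool; true; false; _∧_; _∨_; not; T)
open import Data.Nat using (ℕ; zero; suc; _≡ᵇ_)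
open import Data.Fin using (Fin; _≟_)
open import Data.Fin.Subset using (Subset; ∣_∣)
open import Data.Vec using (Vec; []; _∷_; lookup)
open import Data.List using (List; []; _∷_; map; _++_; length; filter; filterᵇ; allFin; foldr)
open import Data.Bool.ListAction using (all)
open import Data.Integer using (ℤ; _+_; _-_; _≤?_; _≤_) renaming (0ℤ to zeroℤ)
open import Data.Integer using () renaming (+_ to ℤ⁺)
open import Relation.Nullary.Decidable using (does; _×-dec_)
open import Relation.Binary.PropositionalEquality using (_≡_)
open import Data.Empty using (⊥)

record SimpleGraph (n : ℕ) : Set where
  field
    adj     : Fin n → Fin n → Bool
    symm    : ∀ u v → adj u v ≡ adj v u
    irrefl  : ∀ v → adj v v ≡ false
open SimpleGraph public

degree : ∀ {n} → SimpleGraph n → Fin n → ℕ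
degree {n} G v = length (filterᵇ (adj G v) (allFin n))

MaxDegreeAtMost : ∀ {n} → SimpleGraph n → ℕ → Set
MaxDegreeAtMost {n} G Δ = ∀ v → degree G v Data.Nat.≤ Δ

allSubsets : (n : ℕ) → List (Subset n)
allSubsets zero = [] ∷ []
allSubsets (suc n) = map (false ∷_) (allSubsets n) ++ map (true ∷_) (allSubsets n)

isCliqueᵇ : ∀ {n} → SimpleGraph n → Subset n → Bool
isCliqueᵇ {n} G S =
  all (λ i → all (λ j → not (lookup S i ∧ lookup S j ∧ not (does (i ≟ j))) ∨ adj G i j)
                 (allFin n))
      (allFin n)

k[_] : ℕ → ∀ {n} → SimpleGraph n → ℕ
k[ t ] {n} G = length (filterᵇ (λ S → isCliqueᵇ G S ∧ (∣ S ∣ ≡ᵇ t)) (allSubsets n))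

sumV : ∀ {n} → (Fin n → ℤ) → ℤ
sumV {n} w = foldr (λ v acc → w v + acc) zeroℤ (allFin n)

lowNeighbours : ∀ {n} → SimpleGraph n → (Fin n → ℤ) → ℤ → Fin n → ℕ
lowNeighbours {n} G w k v =
  length (filter (λ u → Data.Bool.T? (adj G v u) ×-dec (w u ≤? (k - ℤ⁺ 1))) (allFin n))

-- Split the vertices into the low ones (w ≤ k − 1) and the top ones (w = k); let b be the
-- number of low vertices. Every top vertex sends at least ℓ edges to low vertices and every low
-- vertex receives at most Δ edges, so ℓ (n − b) ≤ Δ b, i.e. b ≥ ℓ n / (ℓ + Δ). Hence
-- t k_t(G) = Σ w ≤ k n − b ≤ n (k − ℓ / (ℓ + Δ)); divide by t n.
module Submission where

open import Data.Bool using (Bool; true; false; _∧_; not; T)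
open import Data.List using (List; []; _∷_; foldr; length; filter; allFin)
open import Data.Nat using (ℕ)
open import Data.Integer as ℤ using (ℤ; +_) renaming (_-_ to _-ℤ_; _≤_ to _≤ℤ_)
open import Data.Fin using (Fin)
open import Data.List.Properties using (length-tabulate)
open import Function using (_∘_; id)
open import Defs
open import Relation.Binary.PropositionalEquality

module ListSum where
  open import Data.Nat using (suc; _+_; _*_; _≤_; z≤n)
  import Data.Nat.Properties as ℕP
  open import Relation.Nullary using (does)
  open import Relation.Unary using (Pred; Decidable)
  open import Level using (0ℓ)

  private variable A B : Set

  𝟙 : Bool → ℕ
  𝟙 true  = 1
  𝟙 false = 0

  ∑ : List A → (A → ℕ) → ℕ
  ∑ xs f = foldr (λ x acc → f x + acc) 0 xs

  count : (A → Bool) → List A → ℕ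
  count p xs = ∑ xs (𝟙 ∘ p)

  ∑-cong : ∀ xs {f g : A → ℕ} → (∀ x → f x ≡ g x) → ∑ xs f ≡ ∑ xs g
  ∑-cong []       f≗g = refl
  ∑-cong (x ∷ xs) f≗g = cong₂ _+_ (f≗g x) (∑-cong xs f≗g)

  ∑-mono-≤ : ∀ xs {f g : A → ℕ} → (∀ x → f x ≤ g x) → ∑ xs f ≤ ∑ xs g
  ∑-mono-≤ []       f≤g = z≤n
  ∑-mono-≤ (x ∷ xs) f≤g = ℕP.+-mono-≤ (f≤g x) (∑-mono-≤ xs f≤g)

  ∑-zero : (xs : List A) → ∑ xs (λ _ → 0) ≡ 0
  ∑-zero []       = refl
  ∑-zero (x ∷ xs) = ∑-zero xs

  ∑-distrib-+ : ∀ xs (f g : A → ℕ) → ∑ xs (λ x → f x + g x) ≡ ∑ xs f + ∑ xs g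
  ∑-distrib-+ []       f g = refl
  ∑-distrib-+ (x ∷ xs) f g = begin
    f x + g x + ∑ xs (λ x → f x + g x) ≡⟨ cong (λ m → f x + g x + m) (∑-distrib-+ xs f g) ⟩
    f x + g x + (∑ xs f + ∑ xs g)      ≡⟨ ℕP.+-assoc (f x) (g x) _ ⟩
    f x + (g x + (∑ xs f + ∑ xs g))    ≡⟨ cong (λ m → f x + m) (ℕP.+-comm (g x) _) ⟩
    f x + ((∑ xs f + ∑ xs g) + g x)    ≡⟨ cong (λ m → f x + m) (ℕP.+-assoc (∑ xs f) _ _) ⟩
    f x + (∑ xs f + (∑ xs g + g x))    ≡⟨ cong (λ m → f x + (∑ xs f + m)) (ℕP.+-comm _ (g x)) ⟩
    f x + (∑ xs f + (g x + ∑ xs g))    ≡⟨ ℕP.+-assoc (f x) _ _ ⟨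
    f x + ∑ xs f + (g x + ∑ xs g)      ∎
    where open ≡-Reasoning

  *-distribˡ-∑ : ∀ c xs (f : A → ℕ) → c * ∑ xs f ≡ ∑ xs (λ x → c * f x)
  *-distribˡ-∑ c []       f = ℕP.*-zeroʳ c
  *-distribˡ-∑ c (x ∷ xs) f =
    trans (ℕP.*-distribˡ-+ c (f x) _) (cong (λ m → c * f x + m) (*-distribˡ-∑ c xs f))

  ∑-comm : (xs : List A) (ys : List B) (f : A → B → ℕ) →
           ∑ xs (λ x → ∑ ys (f x)) ≡ ∑ ys (λ y → ∑ xs (λ x → f x y))
  ∑-comm []       ys f = sym (∑-zero ys)
  ∑-comm (x ∷ xs) ys f = trans (cong (λ m → ∑ ys (f x) + m) (∑-comm xs ys f))
                               (sym (∑-distrib-+ ys (f x) _))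

  length-filter≡count : {P : Pred A 0ℓ} (P? : Decidable P) (xs : List A) →
                        length (filter P? xs) ≡ count (does ∘ P?) xs
  length-filter≡count P? []       = refl
  length-filter≡count P? (x ∷ xs) with does (P? x)
  ... | true  = cong suc (length-filter≡count P? xs)
  ... | false = length-filter≡count P? xs

  count-not+count≡length : ∀ (p : A → Bool) xs → count (not ∘ p) xs + count p xs ≡ length xs
  count-not+count≡length p []       = refl
  count-not+count≡length p (x ∷ xs) with p x
  ... | true  = trans (ℕP.+-suc _ _) (cong suc (count-not+count≡length p xs))
  ... | false = cong suc (count-not+count≡length p xs)

module EdgeCounting {n : ℕ} (G : SimpleGraph n) where
  open import Data.Nat using (_*_; _≤_; z≤n; s≤s)
  import Data.Nat.Properties as ℕP
  open import Relation.Nullary.Decidable using (T?)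
  open ListSum

  neighboursIn : (Fin n → Bool) → Fin n → ℕ
  neighboursIn B v = count (λ u → adj G v u ∧ B u) (allFin n)

  degree≡count : ∀ v → degree G v ≡ count (adj G v) (allFin n)
  degree≡count v = length-filter≡count (T? ∘ adj G v) (allFin n)

  private
    ℓ*𝟙≤𝟙* : ∀ {ℓ m} a → (T a → ℓ ≤ m) → ℓ * 𝟙 a ≤ 𝟙 a * m
    ℓ*𝟙≤𝟙* {ℓ} {m} true  ℓ≤m = subst₂ _≤_ (sym (ℕP.*-identityʳ ℓ)) (sym (ℕP.*-identityˡ m)) (ℓ≤m _)
    ℓ*𝟙≤𝟙* {ℓ}     false _   = ℕP.≤-reflexive (ℕP.*-zeroʳ ℓ)

    𝟙*𝟙∧≤𝟙*𝟙 : ∀ a b c → 𝟙 a * 𝟙 (b ∧ c) ≤ 𝟙 c * 𝟙 b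
    𝟙*𝟙∧≤𝟙*𝟙 false b     c     = z≤n
    𝟙*𝟙∧≤𝟙*𝟙 true  false c     = z≤n
    𝟙*𝟙∧≤𝟙*𝟙 true  true  false = z≤n
    𝟙*𝟙∧≤𝟙*𝟙 true  true  true  = s≤s z≤n

  -- ℓ |A| ≤ e(A, B) ≤ Δ |B|.
  ℓ*count≤Δ*count : ∀ {Δ ℓ} → MaxDegreeAtMost G Δ → (A B : Fin n → Bool) →
                    (∀ v → T (A v) → ℓ ≤ neighboursIn B v) →
                    ℓ * count A (allFin n) ≤ Δ * count B (allFin n)
  ℓ*count≤Δ*count {Δ} {ℓ} maxDeg A B many = begin
    ℓ * count A V                                              ≡⟨ *-distribˡ-∑ ℓ V (𝟙 ∘ A) ⟩
    ∑ V (λ v → ℓ * 𝟙 (A v))                                    ≤⟨ ∑-mono-≤ V (λ v → ℓ*𝟙≤𝟙* (A v) (many v)) ⟩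
    ∑ V (λ v → 𝟙 (A v) * neighboursIn B v)                     ≡⟨ ∑-cong V (λ v → *-distribˡ-∑ (𝟙 (A v)) V _) ⟩
    ∑ V (λ v → ∑ V (λ u → 𝟙 (A v) * 𝟙 (adj G v u ∧ B u)))     ≡⟨ ∑-comm V V _ ⟩
    ∑ V (λ u → ∑ V (λ v → 𝟙 (A v) * 𝟙 (adj G v u ∧ B u)))     ≤⟨ ∑-mono-≤ V (λ u → ∑-mono-≤ V (λ v → edge-term u v)) ⟩
    ∑ V (λ u → ∑ V (λ v → 𝟙 (B u) * 𝟙 (adj G u v)))           ≡⟨ ∑-cong V (λ u → sym (*-distribˡ-∑ (𝟙 (B u)) V _)) ⟩
    ∑ V (λ u → 𝟙 (B u) * count (adj G u) V)                    ≡⟨ ∑-cong V (λ u → cong (𝟙 (B u) *_) (sym (degree≡count u))) ⟩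
    ∑ V (λ u → 𝟙 (B u) * degree G u)                           ≤⟨ ∑-mono-≤ V (λ u → low-degree u) ⟩
    ∑ V (λ u → Δ * 𝟙 (B u))                                    ≡⟨ *-distribˡ-∑ Δ V (𝟙 ∘ B) ⟨
    Δ * count B V                                              ∎
    where
    open ℕP.≤-Reasoning
    V = allFin n
    edge-term : ∀ u v → 𝟙 (A v) * 𝟙 (adj G v u ∧ B u) ≤ 𝟙 (B u) * 𝟙 (adj G u v)
    edge-term u v = subst (λ e → 𝟙 (A v) * 𝟙 (adj G v u ∧ B u) ≤ 𝟙 (B u) * 𝟙 e) (symm G v u)
                          (𝟙*𝟙∧≤𝟙*𝟙 (A v) (adj G v u) (B u))
    low-degree : ∀ u → 𝟙 (B u) * degree G u ≤ Δ * 𝟙 (B u)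
    low-degree u = ℕP.≤-trans (ℕP.*-monoʳ-≤ (𝟙 (B u)) (maxDeg u))
                              (ℕP.≤-reflexive (ℕP.*-comm (𝟙 (B u)) Δ))

module LowVertices {V : Set} (w : V → ℤ) (k : ℤ) where
  open import Data.Integer using (_+_; _*_; _≤_; _≤?_; pred) renaming (0ℤ to zeroℤ)
  import Data.Integer.Properties as ℤP
  open import Data.Integer.Tactic.RingSolver using (solve-∀)
  open import Relation.Nullary.Decidable using (does; yes; no)
  open ListSum

  isLow : V → Bool
  isLow v = does (w v ≤? k -ℤ + 1)

  private
    k-1≡pred : k -ℤ + 1 ≡ pred k
    k-1≡pred = ℤP.+-comm k (ℤ.- + 1)

  ≤-minus-𝟙-isLow : ∀ {v} → w v ≤ k → w v ≤ k -ℤ + 𝟙 (isLow v)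
  ≤-minus-𝟙-isLow {v} w≤k with w v ≤? k -ℤ + 1
  ... | yes w≤k-1 = w≤k-1
  ... | no  _     = subst (w v ≤_) (sym (ℤP.+-identityʳ k)) w≤k

  ¬isLow⇒≡ : ∀ {v} → w v ≤ k → T (not (isLow v)) → w v ≡ k
  ¬isLow⇒≡ {v} w≤k notLow with w v ≤? k -ℤ + 1
  ... | no w≰k-1 = ℤP.≤∧≮⇒≡ w≤k (w≰k-1 ∘ subst (w v ≤_) (sym k-1≡pred) ∘ ℤP.i<j⇒i≤pred[j])

  sum≤k*length-count : (∀ v → w v ≤ k) → ∀ xs →
                       foldr (λ v acc → w v + acc) zeroℤ xs ≤ k * + length xs -ℤ + count isLow xs
  sum≤k*length-count w≤k []       = ℤP.≤-reflexive (sym (trans (ℤP.+-identityʳ _) (ℤP.*-zeroʳ k)))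
  sum≤k*length-count w≤k (x ∷ xs) = ℤP.≤-trans
    (ℤP.+-mono-≤ (≤-minus-𝟙-isLow (w≤k x)) (sum≤k*length-count w≤k xs))
    (ℤP.≤-reflexive (regroup k (+ length xs) (+ 𝟙 (isLow x)) (+ count isLow xs)))
    where
    regroup : ∀ k m i c → (k -ℤ i) + (k * m -ℤ c) ≡ k * (+ 1 + m) -ℤ (i + c)
    regroup = solve-∀

module LowVertexCount {n : ℕ} (G : SimpleGraph n) {Δ : ℕ} (maxDeg : MaxDegreeAtMost G Δ)
                      (w : Fin n → ℤ) (k : ℤ) (w≤k : ∀ v → w v ≤ℤ k) where
  open import Data.Nat using (_+_; _*_; _≤_)
  import Data.Nat.Properties as ℕP
  open ListSum
  open EdgeCounting G
  open LowVertices w k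

  private
    ℓ*[a+b]≤[ℓ+Δ]*b : ∀ ℓ a b → ℓ * a ≤ Δ * b → ℓ * (a + b) ≤ (ℓ + Δ) * b
    ℓ*[a+b]≤[ℓ+Δ]*b ℓ a b ℓa≤Δb = begin
      ℓ * (a + b)   ≡⟨ ℕP.*-distribˡ-+ ℓ a b ⟩
      ℓ * a + ℓ * b ≤⟨ ℕP.+-monoˡ-≤ (ℓ * b) ℓa≤Δb ⟩
      Δ * b + ℓ * b ≡⟨ ℕP.+-comm (Δ * b) (ℓ * b) ⟩
      ℓ * b + Δ * b ≡⟨ ℕP.*-distribʳ-+ b ℓ Δ ⟨
      (ℓ + Δ) * b   ∎
      where open ℕP.≤-Reasoning

  ℓ*n≤[ℓ+Δ]*count-isLow : ∀ ℓ → (∀ v → w v ≡ k → ℓ ≤ lowNeighbours G w k v) →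
                          ℓ * n ≤ (ℓ + Δ) * count isLow (allFin n)
  ℓ*n≤[ℓ+Δ]*count-isLow ℓ many = subst (λ m → ℓ * m ≤ (ℓ + Δ) * count isLow (allFin n)) n≡a+b
    (ℓ*[a+b]≤[ℓ+Δ]*b ℓ _ _ (ℓ*count≤Δ*count maxDeg (not ∘ isLow) isLow top-many))
    where
    n≡a+b : count (not ∘ isLow) (allFin n) + count isLow (allFin n) ≡ n
    n≡a+b = trans (count-not+count≡length isLow (allFin n)) (length-tabulate id)
    top-many : ∀ v → T (not (isLow v)) → ℓ ≤ neighboursIn isLow v
    top-many v top = subst (ℓ ≤_) (length-filter≡count _ (allFin n)) (many v (¬isLow⇒≡ (w≤k v) top))

module ClearingDenominators where
  open import Data.Nat as ℕ using (suc; NonZero)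
  import Data.Nat.Properties as ℕP
  open import Data.Integer using (_+_; _*_; -_; _≤_; +≤+)
  import Data.Integer.Properties as ℤP
  open import Data.Integer.Tactic.RingSolver using (solve-∀)
  open import Data.Rational using (_/_; toℚᵘ) renaming (_*_ to _*ℚ_; _-_ to _-ℚ_; _≤_ to _≤ℚ_)
  import Data.Rational.Properties as ℚP
  import Data.Rational.Unnormalised as ℚᵘ
  import Data.Rational.Unnormalised.Properties as ℚᵘP

  toℚᵘ-/ : ∀ z d .{{_ : NonZero d}} → toℚᵘ (z / d) ℚᵘ.≃ (z ℚᵘ./ d)
  toℚᵘ-/ z (suc d) = ℚP.toℚᵘ-fromℚᵘ (ℚᵘ.mkℚᵘ z d)

  cleared-bound : (K t n L ℓ b : ℕ) (S k : ℤ) → + K * + t ≡ S → S ≤ k * + n -ℤ + b →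
                  ℓ ℕ.* n ℕ.≤ L ℕ.* b → + K * + t * + L ≤ (k * + L -ℤ + ℓ) * + n
  cleared-bound K t n L ℓ b S k Kt≡S S≤kn-b ℓn≤Lb = begin
    + K * + t * + L              ≡⟨ cong (_* + L) Kt≡S ⟩
    S * + L                      ≤⟨ ℤP.*-monoʳ-≤-nonNeg (+ L) S≤kn-b ⟩
    (k * + n -ℤ + b) * + L       ≡⟨ expand k (+ n) (+ b) (+ L) ⟩
    k * + n * + L -ℤ + L * + b   ≡⟨ cong (λ x → k * + n * + L -ℤ x) (ℤP.pos-* L b) ⟨
    k * + n * + L -ℤ + (L ℕ.* b) ≤⟨ ℤP.+-monoʳ-≤ (k * + n * + L) (ℤP.neg-mono-≤ (+≤+ ℓn≤Lb)) ⟩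
    k * + n * + L -ℤ + (ℓ ℕ.* n) ≡⟨ cong (λ x → k * + n * + L -ℤ x) (ℤP.pos-* ℓ n) ⟩
    k * + n * + L -ℤ + ℓ * + n   ≡⟨ factor k (+ n) (+ L) (+ ℓ) ⟩
    (k * + L -ℤ + ℓ) * + n       ∎
    where
    open ℤP.≤-Reasoning
    expand : ∀ k n b L → (k * n -ℤ b) * L ≡ k * n * L -ℤ L * b
    expand = solve-∀
    factor : ∀ k n L ℓ → k * n * L -ℤ ℓ * n ≡ (k * L -ℤ ℓ) * n
    factor = solve-∀

  K≡S/t⇒K*t≡S : ∀ t .{{_ : NonZero t}} K S → (+ K / 1) ≡ (+ 1 / t) *ℚ (S / 1) → + K * + t ≡ S
  K≡S/t⇒K*t≡S (suc t) K S K≡S/t = from-≃ (ℚᵘP.≃-trans (ℚᵘP.≃-sym (toℚᵘ-/ (+ K) 1))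
    (ℚᵘP.≃-trans (ℚP.toℚᵘ-cong K≡S/t) (ℚᵘP.≃-trans (ℚP.toℚᵘ-homo-* (+ 1 / suc t) _)
      (ℚᵘP.*-cong (toℚᵘ-/ (+ 1) (suc t)) (toℚᵘ-/ S 1)))))
    where
    open ≡-Reasoning
    from-≃ : (+ K ℚᵘ./ 1) ℚᵘ.≃ ((+ 1 ℚᵘ./ suc t) ℚᵘ.* (S ℚᵘ./ 1)) → + K * + suc t ≡ S
    from-≃ (ℚᵘ.*≡* cross-eq) = begin
      + K * + suc t            ≡⟨ cong (λ m → + K * + m) (ℕP.*-identityʳ (suc t)) ⟨
      + K * + (suc t ℕ.* 1)    ≡⟨ cross-eq ⟩
      + 1 * S * + 1            ≡⟨ ℤP.*-identityʳ (+ 1 * S) ⟩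
      + 1 * S                  ≡⟨ ℤP.*-identityˡ S ⟩
      S                        ∎

  cross-multiplied⇒≤ : ∀ n t L .{{_ : NonZero n}} .{{_ : NonZero t}} .{{_ : NonZero L}} K k ℓ →
                       + K * + t * + L ≤ (k * + L -ℤ + ℓ) * + n →
                       (+ K / n) ≤ℚ ((+ 1 / t) *ℚ ((k / 1) -ℚ (+ ℓ / L)))
  cross-multiplied⇒≤ (suc n) (suc t) (suc L) K k ℓ KtL≤[kL-ℓ]n =
    ℚP.toℚᵘ-cancel-≤ (ℚᵘP.≤-respˡ-≃ (ℚᵘP.≃-sym (toℚᵘ-/ (+ K) (suc n)))
                       (ℚᵘP.≤-respʳ-≃ (ℚᵘP.≃-sym rhs≃) (ℚᵘ.*≤* (subst₂ _≤_ lhs≡ rhs≡ KtL≤[kL-ℓ]n))))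
    where
    open ≡-Reasoning
    rhs≃ : toℚᵘ ((+ 1 / suc t) *ℚ ((k / 1) -ℚ (+ ℓ / suc L)))
           ℚᵘ.≃ ((+ 1 ℚᵘ./ suc t) ℚᵘ.* ((k ℚᵘ./ 1) ℚᵘ.- (+ ℓ ℚᵘ./ suc L)))
    rhs≃ = ℚᵘP.≃-trans (ℚP.toℚᵘ-homo-* (+ 1 / suc t) _) (ℚᵘP.*-cong (toℚᵘ-/ (+ 1) (suc t))
             (ℚᵘP.≃-trans (ℚP.toℚᵘ-homo-+ (k / 1) _) (ℚᵘP.+-cong (toℚᵘ-/ k 1)
               (ℚᵘP.≃-trans (ℚP.toℚᵘ-homo‿- (+ ℓ / suc L)) (ℚᵘP.-‿cong (toℚᵘ-/ (+ ℓ) (suc L)))))))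
    -- lhs≡ and rhs≡ reshape the bound into the unreduced numerators and denominators of ℚᵘ arithmetic.
    lhs≡ : + K * + suc t * + suc L ≡ + K * + (suc t ℕ.* (1 ℕ.* suc L))
    lhs≡ = begin
      + K * + suc t * + suc L            ≡⟨ ℤP.*-assoc (+ K) (+ suc t) (+ suc L) ⟩
      + K * + (suc t ℕ.* suc L)          ≡⟨ cong (λ m → + K * + (suc t ℕ.* m)) (ℕP.*-identityˡ (suc L)) ⟨
      + K * + (suc t ℕ.* (1 ℕ.* suc L))  ∎
    normalise : ∀ k L ℓ → k * L -ℤ ℓ ≡ + 1 * (k * L + - ℓ * + 1)
    normalise = solve-∀
    rhs≡ : (k * + suc L -ℤ + ℓ) * + suc n ≡ + 1 * (k * + suc L + - (+ ℓ) * + 1) * + suc n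
    rhs≡ = cong (_* + suc n) (normalise k (+ suc L) (+ ℓ))

open ListSum using (count)
open LowVertices using (isLow; sum≤k*length-count)
open LowVertexCount using (ℓ*n≤[ℓ+Δ]*count-isLow)
open ClearingDenominators using (K≡S/t⇒K*t≡S; cleared-bound; cross-multiplied⇒≤)

open import Data.Nat using (ℕ; NonZero; _+_; _≤_)
open import Data.Rational using (_/_; _*_; _-_) renaming (_≤_ to _≤ℚ_)

lemma6p1 : (n : ℕ) → .{{_ : NonZero n}} → (G : SimpleGraph n) →
    (Δ t : ℕ) → .{{_ : NonZero t}} → (k : ℤ) → (ℓ : ℕ) → .{{_ : NonZero (ℓ + Δ)}} →
    MaxDegreeAtMost G Δ →
    (w : Fin n → ℤ) →
    (+ (k[ t ] G) / 1) ≡ (+ 1 / t) * (sumV w / 1) →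
    (∀ v → w v ≤ℤ k) →
    (∀ v → w v ≡ k → ℓ ≤ lowNeighbours G w k v) →
    (+ (k[ t ] G) / n) ≤ℚ ((+ 1 / t) * ((k / 1) - (+ ℓ / (ℓ + Δ))))
lemma6p1 n G Δ t k ℓ maxDeg w avg w≤k many =
  cross-multiplied⇒≤ n t (ℓ + Δ) (k[ t ] G) k ℓ
    (cleared-bound (k[ t ] G) t n (ℓ + Δ) ℓ #low (sumV w) k
      (K≡S/t⇒K*t≡S t (k[ t ] G) (sumV w) avg)
      sum≤kn-#low
      (ℓ*n≤[ℓ+Δ]*count-isLow G maxDeg w k w≤k ℓ many))
  where
  #low : ℕ
  #low = count (isLow w k) (allFin n)
  sum≤kn-#low : sumV w ≤ℤ k ℤ.* + n -ℤ + #low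
  sum≤kn-#low = subst (λ m → sumV w ≤ℤ k ℤ.* + m -ℤ + #low) (length-tabulate id)
                      (sum≤k*length-count w k w≤k (allFin n))
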